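{- Let $X,Y$ be simplicial complexes on ground set $[n]$. If the support system $\mathrm{Supp}_X(Y)$ is nonempty, then it is meet-closed and interval-closed in the partition lattice $\Pi_n$.
   Context: A simplicial complex on $[n]$ is a family $X\subseteq2^{[n]}$ with $\emptyset\in X$, closed under taking subsets. For $S\subseteq[n]$, $X|_S=\{\sigma\in X:\sigma\subseteq S\}$. For a set partition $\Phi=\{\Phi_1,\dots,\Phi_k\}$ of $[n]$, $X_\Phi=\{\sigma_1\cup\cdots\cup\sigma_k:\sigma_i\in X,\sigma_i\subseteq\Phi_i\}$. $\Pi_n$ is the lattice of set partitions of $[n]$ ordered by reverse refinement ($\Phi\le\Psi$ if every block of $\Psi$ is a union of blocks of $\Phi$); the meet $\Phi\wedge\Psi$ is the coarsest common refinement. $\mathrm{Supp}_X(Y)=\{\Phi\in\Pi_n:X_\Phi=Y\}$. A subset $\mathcal{S}\subseteq\Pi_n$ is meet-closed if $\Phi,\Psi\in\mathcal{S}\Rightarrow\Phi\wedge\Psi\in\mathcal{S}$, and interval-closed if $\Phi\le\Psi\le\Omega$ with $\Phi,\Omega\in\mathcal{S}$ implies $\Psi\in\mathcal{S}$. -}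

module Defs where

open import Data.Nat using (ℕ)
open import Data.Fin using (Fin)
open import Data.Fin.Subset using (Subset; ⊥; _∈_; _⊆_)
open import Data.Product using (Σ; ∃; _×_)
open import Relation.Binary.PropositionalEquality using (_≡_)
open import Function.Bundles using (_⇔_)

record SimplicialComplex (n : ℕ) : Set₁ where
  field
    face      : Subset n → Set
    empty     : face ⊥
    downClose : ∀ {σ τ} → τ ⊆ σ → face σ → face τ
open SimplicialComplex public

-- A set partition of [n], given by a block-labelling: i and j lie in the
-- same block iff they carry the same label.  Block with label b is
-- { i | Φ i ≡ b } (possibly empty for unused labels).
Partition : ℕ → Set
Partition n = Fin n → ℕ

SameBlock : ∀ {n} → Partition n → Fin n → Fin n → Set
SameBlock Φ i j = Φ i ≡ Φ j

_≤Π_ : ∀ {n} → Partition n → Partition n → Set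
Φ ≤Π Ψ = ∀ i j → SameBlock Φ i j → SameBlock Ψ i j

_≈Π_ : ∀ {n} → Partition n → Partition n → Set
Φ ≈Π Ψ = ∀ i j → SameBlock Φ i j ⇔ SameBlock Ψ i j

IsMeet : ∀ {n} → Partition n → Partition n → Partition n → Set
IsMeet Φ Ψ Ω = ∀ i j → SameBlock Ω i j ⇔ (SameBlock Φ i j × SameBlock Ψ i j)

-- σ ∈ X_Φ : σ = ⋃_b σ_b with σ_b ∈ X and σ_b ⊆ (block b of Φ).
FaceOfRestr : ∀ {n} → SimplicialComplex n → Partition n → Subset n → Set
FaceOfRestr {n} X Φ σ =
  Σ (ℕ → Subset n) λ τ →
    (∀ b → face X (τ b)) ×
    (∀ b i → i ∈ τ b → Φ i ≡ b) ×
    (∀ i → i ∈ σ ⇔ ∃ λ b → i ∈ τ b)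

RestrEq : ∀ {n} → SimplicialComplex n → Partition n → SimplicialComplex n → Set
RestrEq X Φ Y = ∀ σ → FaceOfRestr X Φ σ ⇔ face Y σ

InSupp : ∀ {n} → SimplicialComplex n → SimplicialComplex n → Partition n → Set
InSupp X Y Φ = RestrEq X Φ Y

MeetClosed : ∀ {n} → (Partition n → Set) → Set
MeetClosed S = ∀ Φ Ψ Ω → IsMeet Φ Ψ Ω → S Φ → S Ψ → S Ω

IntervalClosed : ∀ {n} → (Partition n → Set) → Set
IntervalClosed S = ∀ Φ Ψ Ω → Φ ≤Π Ψ → Ψ ≤Π Ω → S Φ → S Ω → S Ψ

{-# OPTIONS --safe #-}
-- σ ∈ X_Φ holds exactly when σ meets every block of Φ in a face of X.  From
-- this, coarsening Φ can only shrink X_Φ, which gives interval-closedness at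
-- once.  For the meet Ω = Φ ∧ Ψ, coarsening gives X_Φ ⊆ X_Ω; conversely, if
-- σ ∈ X_Ω and C is a block of Ψ, then σ ∩ C meets each block of Φ inside a
-- block of Ω, so σ ∩ C ∈ X_Φ = Y = X_Ψ, whence σ ∩ C ∈ X and σ ∈ X_Ψ = Y.
module Submission where

open import Defs
open import Data.Nat using (ℕ; _≟_)
open import Data.Product using (∃; _×_; _,_; proj₁; proj₂)
open import Data.Bool.Properties using (T-≡)
open import Data.Fin using (Fin)
open import Data.Fin.Subset using (Subset; _∈_; _⊆_; _∩_)
open import Data.Fin.Subset.Properties using (x∈p∩q⁺; x∈p∩q⁻; nonempty?; Empty-unique)
open import Data.Vec using (tabulate)
open import Data.Vec.Properties using ([]=⇒lookup; lookup⇒[]=; lookup∘tabulate)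
open import Relation.Nullary using (yes; no)
open import Relation.Nullary.Decidable using (⌊_⌋; toWitness; fromWitness)
open import Relation.Binary.PropositionalEquality using (_≡_; refl; sym; trans; subst)
open import Function.Base using (_∘_; id)
open import Function.Bundles using (_⇔_; mk⇔; Equivalence)

private
  variable
    n : ℕ
    Φ Ψ Ω : Partition n
    σ τ : Subset n

block : Partition n → ℕ → Subset n
block Φ b = tabulate (λ i → ⌊ Φ i ≟ b ⌋)

∈-block : ∀ {i : Fin n} {b} → i ∈ block Φ b ⇔ Φ i ≡ b
∈-block {Φ = Φ} {i} {b} = mk⇔
  (λ i∈ → toWitness {a? = Φ i ≟ b} (Equivalence.from T-≡
            (trans (sym (lookup∘tabulate _ i)) ([]=⇒lookup i∈))))
  (λ eq → lookup⇒[]= i (block Φ b)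
            (trans (lookup∘tabulate _ i) (Equivalence.to T-≡ (fromWitness eq))))

WithinBlock : Partition n → Subset n → Set
WithinBlock Φ τ = ∀ {i j} → i ∈ τ → j ∈ τ → SameBlock Φ i j

∩-block-withinBlock : ∀ b → WithinBlock Φ (σ ∩ block Φ b)
∩-block-withinBlock {σ = σ} b i∈ j∈ =
  trans (on-block i∈) (sym (on-block j∈))
  where
  on-block : ∀ {i} → i ∈ σ ∩ block _ b → _ ≡ b
  on-block i∈ = Equivalence.to ∈-block (proj₂ (x∈p∩q⁻ σ _ i∈))

withinBlock-mono : Φ ≤Π Ψ → WithinBlock Φ τ → WithinBlock Ψ τ
withinBlock-mono Φ≤Ψ within i∈ j∈ = Φ≤Ψ _ _ (within i∈ j∈)

withinBlock-meet : IsMeet Φ Ψ Ω → WithinBlock Φ τ → WithinBlock Ψ τ → WithinBlock Ω τ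
withinBlock-meet meet withinΦ withinΨ i∈ j∈ =
  Equivalence.from (meet _ _) (withinΦ i∈ j∈ , withinΨ i∈ j∈)

meet≤ˡ : IsMeet Φ Ψ Ω → Ω ≤Π Φ
meet≤ˡ meet i j same = proj₁ (Equivalence.to (meet i j) same)

module _ (X : SimplicialComplex n) where

  Blockwise : Partition n → Subset n → Set
  Blockwise Φ σ = ∀ b → face X (σ ∩ block Φ b)

  faceOfRestr⇔blockwise : FaceOfRestr X Φ σ ⇔ Blockwise Φ σ
  faceOfRestr⇔blockwise {Φ = Φ} {σ = σ} = mk⇔ to from
    where
    to : FaceOfRestr X Φ σ → Blockwise Φ σ
    to (τ , τ-face , τ-block , σ≡⋃τ) b = downClose X σ∩Φb⊆τb (τ-face b)
      where
      σ∩Φb⊆τb : σ ∩ block Φ b ⊆ τ b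
      σ∩Φb⊆τb {i} i∈ with x∈p∩q⁻ σ _ i∈
      ... | i∈σ , i∈Φb with Equivalence.to (σ≡⋃τ i) i∈σ
      ... | c , i∈τc = subst (λ c → i ∈ τ c)
                         (trans (sym (τ-block c i i∈τc)) (Equivalence.to ∈-block i∈Φb)) i∈τc

    from : Blockwise Φ σ → FaceOfRestr X Φ σ
    from blockwise =
      (λ b → σ ∩ block Φ b) , blockwise ,
      (λ b i i∈ → Equivalence.to ∈-block (proj₂ (x∈p∩q⁻ σ _ i∈))) ,
      λ i → mk⇔ (λ i∈σ → Φ i , x∈p∩q⁺ (i∈σ , Equivalence.from ∈-block refl))
                (λ (b , i∈) → proj₁ (x∈p∩q⁻ σ _ i∈))

  -- A nonempty τ lies in σ ∩ (the block of any of its elements); an empty τ is ∅.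
  blockwise-face : Blockwise Φ σ → τ ⊆ σ → WithinBlock Φ τ → face X τ
  blockwise-face {Φ = Φ} {σ = σ} {τ = τ} blockwise τ⊆σ within with nonempty? τ
  ... | yes (i , i∈τ) = downClose X τ⊆σ∩block (blockwise (Φ i))
    where
    τ⊆σ∩block : τ ⊆ σ ∩ block Φ (Φ i)
    τ⊆σ∩block j∈τ = x∈p∩q⁺ (τ⊆σ j∈τ , Equivalence.from ∈-block (within j∈τ i∈τ))
  ... | no τ-empty = subst (face X) (sym (Empty-unique τ-empty)) (empty X)

  blockwise-mono : Φ ≤Π Ψ → Blockwise Ψ σ → Blockwise Φ σ
  blockwise-mono {σ = σ} Φ≤Ψ blockwise b =
    blockwise-face blockwise (λ i∈ → proj₁ (x∈p∩q⁻ σ _ i∈))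
      (withinBlock-mono Φ≤Ψ (∩-block-withinBlock b))

  blockwise-meet : IsMeet Φ Ψ Ω → Blockwise Ω σ → ∀ c → Blockwise Φ (σ ∩ block Ψ c)
  blockwise-meet {σ = σ} meet blockwise c b =
    blockwise-face blockwise (λ i∈ → proj₁ (x∈p∩q⁻ σ _ (proj₁ (x∈p∩q⁻ _ _ i∈))))
      (withinBlock-meet meet (∩-block-withinBlock b)
        (λ i∈ j∈ → ∩-block-withinBlock c (proj₁ (x∈p∩q⁻ _ _ i∈)) (proj₁ (x∈p∩q⁻ _ _ j∈))))

  module _ (Y : SimplicialComplex n) where

    blockwise⇒face : InSupp X Y Φ → ∀ σ → Blockwise Φ σ → face Y σ
    blockwise⇒face supp σ = Equivalence.to (supp σ) ∘ Equivalence.from faceOfRestr⇔blockwise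

    face⇒blockwise : InSupp X Y Φ → ∀ σ → face Y σ → Blockwise Φ σ
    face⇒blockwise supp σ = Equivalence.to faceOfRestr⇔blockwise ∘ Equivalence.from (supp σ)

    blockwise⇒inSupp : (∀ σ → Blockwise Φ σ ⇔ face Y σ) → InSupp X Y Φ
    blockwise⇒inSupp equiv σ = mk⇔
      (Equivalence.to (equiv σ) ∘ Equivalence.to faceOfRestr⇔blockwise)
      (Equivalence.from faceOfRestr⇔blockwise ∘ Equivalence.from (equiv σ))

    blockwise-meet⇒blockwise : IsMeet Φ Ψ Ω → InSupp X Y Φ → InSupp X Y Ψ →
                               ∀ σ → Blockwise Ω σ → Blockwise Ψ σ
    blockwise-meet⇒blockwise {Ψ = Ψ} meet suppΦ suppΨ σ blockwiseΩ c =
      blockwise-face (face⇒blockwise suppΨ _ σ∩C∈Y) id (∩-block-withinBlock c)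
      where
      σ∩C∈Y : face Y (σ ∩ block Ψ c)
      σ∩C∈Y = blockwise⇒face suppΦ _ (blockwise-meet meet blockwiseΩ c)

    inSupp-meet : IsMeet Φ Ψ Ω → InSupp X Y Φ → InSupp X Y Ψ → InSupp X Y Ω
    inSupp-meet meet suppΦ suppΨ = blockwise⇒inSupp λ σ → mk⇔
      (blockwise⇒face suppΨ σ ∘ blockwise-meet⇒blockwise meet suppΦ suppΨ σ)
      (blockwise-mono (meet≤ˡ meet) ∘ face⇒blockwise suppΦ σ)

    inSupp-interval : Φ ≤Π Ψ → Ψ ≤Π Ω → InSupp X Y Φ → InSupp X Y Ω → InSupp X Y Ψ
    inSupp-interval Φ≤Ψ Ψ≤Ω suppΦ suppΩ = blockwise⇒inSupp λ σ → mk⇔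
      (blockwise⇒face suppΦ σ ∘ blockwise-mono Φ≤Ψ)
      (blockwise-mono Ψ≤Ω ∘ face⇒blockwise suppΩ σ)

corollary5p2 : ∀ (n : ℕ) (X Y : SimplicialComplex n) →
    ∃ (λ Φ → InSupp X Y Φ) →
    MeetClosed (InSupp X Y) × IntervalClosed (InSupp X Y)
corollary5p2 n X Y _ =
  (λ Φ Ψ Ω meet → inSupp-meet X Y meet) ,
  (λ Φ Ψ Ω → inSupp-interval X Y)
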